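{- If a finite simple graph $G$ contains no simple circuit (cycle) of length $4$ or more, then $ch(L(G))=\chi(L(G))$, where $L(G)$ is the line graph of $G$.
   Context: $ch(H)$, the choice number of $H$, is the smallest $n$ such that for every assignment of sets $S(v)$ of size $n$ to the vertices of $H$ there is a proper vertex colouring of $H$ assigning each vertex $v$ a colour from $S(v)$. -}

module Defs where

open import Data.Nat using (ℕ; zero; suc; _≤_)
open import Data.Fin using (Fin; inject₁; fromℕ) renaming (_<_ to _<ᶠ_; zero to fzero; suc to fsuc)
open import Data.Bool using (Bool; true; false; T)
open import Data.List using (List; length)
open import Data.List.Membership.Propositional using (_∈_)
open import Data.List.Relation.Unary.Unique.Propositional using (Unique)
open import Data.Product using (Σ; Σ-syntax; _×_; _,_; proj₁; proj₂)
open import Data.Sum using (_⊎_)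
open import Relation.Binary.PropositionalEquality using (_≡_; _≢_)
open import Relation.Nullary using (¬_)
open import Function.Definitions using (Injective)

record SimpleGraph (n : ℕ) : Set where
  field
    adj    : Fin n → Fin n → Bool
    sym    : ∀ u v → adj u v ≡ adj v u
    irrefl : ∀ v → adj v v ≡ false
open SimpleGraph public

Adj : ∀ {n} → SimpleGraph n → Fin n → Fin n → Set
Adj G u v = T (adj G u v)

-- A simple circuit (cycle) of length suc l in G: an injective sequence of
-- vertices c 0, …, c l with consecutive vertices adjacent and c l adjacent to c 0.
IsCycle : ∀ {n} (G : SimpleGraph n) (l : ℕ) → (Fin (suc l) → Fin n) → Set
IsCycle G l c =
  Injective _≡_ _≡_ c ×
  ((i : Fin l) → Adj G (c (inject₁ i)) (c (fsuc i))) ×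
  Adj G (c (fromℕ l)) (c fzero)

HasLongCycle : ∀ {n} → SimpleGraph n → Set
HasLongCycle {n} G =
  Σ[ l ∈ ℕ ] (3 ≤ l × Σ[ c ∈ (Fin (suc l) → Fin n) ] IsCycle G l c)

Edge : ∀ {n} → SimpleGraph n → Set
Edge {n} G = Σ[ u ∈ Fin n ] Σ[ v ∈ Fin n ] (u <ᶠ v × Adj G u v)

src tgt : ∀ {n} {G : SimpleGraph n} → Edge G → Fin n
src e = proj₁ e
tgt e = proj₁ (proj₂ e)

LineAdj : ∀ {n} (G : SimpleGraph n) → Edge G → Edge G → Set
LineAdj G e f =
  e ≢ f ×
  (src {G = G} e ≡ src {G = G} f ⊎ src {G = G} e ≡ tgt {G = G} f ⊎
   tgt {G = G} e ≡ src {G = G} f ⊎ tgt {G = G} e ≡ tgt {G = G} f)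

Colourable : {V : Set} → (V → V → Set) → ℕ → Set
Colourable {V} R k =
  Σ[ c ∈ (V → Fin k) ] (∀ x y → R x y → c x ≢ c y)

IsChromaticNumber : {V : Set} → (V → V → Set) → ℕ → Set
IsChromaticNumber R k = Colourable R k × (∀ m → Colourable R m → k ≤ m)

-- k-choosable: for every assignment of sets S(v) of size k (colours from ℕ,
-- a set of size k is a duplicate-free list of length k) there is a proper
-- colouring choosing each colour from its list.
Choosable : {V : Set} → (V → V → Set) → ℕ → Set
Choosable {V} R k =
  (S : V → List ℕ) → (∀ v → length (S v) ≡ k) → (∀ v → Unique (S v)) →
  Σ[ c ∈ (V → ℕ) ] ((∀ v → c v ∈ S v) × (∀ x y → R x y → c x ≢ c y))

IsChoiceNumber : {V : Set} → (V → V → Set) → ℕ → Set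
IsChoiceNumber R k = Choosable R k × (∀ m → Choosable R m → k ≤ m)

module Submission where

-- Let k = max (Δ(G), 3 if G contains a triangle, 0 otherwise). The edges at a vertex and the edges of a
-- triangle are cliques in L(G), so every proper colouring of L(G) needs k colours. Conversely L(G) is
-- k-choosable. If G has no cycle of length ≥ 4 but has an edge, the end of a maximal path yields an edge ab
-- with deg a = 1, or a triangle abc with deg a = deg b = 2. Either way deg a + deg b ≤ k + 1, so ab meets
-- fewer than k other edges and every list colouring of G − ab extends to G; induct on the number of edges.

open import Defs hiding (sym)

open import Data.Bool using (T; _∧_; not; if_then_else_)
open import Data.Bool.Properties using (T?; T-∧; T-irrelevant)
open import Data.Empty using (⊥-elim)
open import Data.Fin using (Fin; zero; suc; toℕ; inject₁; fromℕ; fromℕ<; _≟_)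
import Data.Fin.Properties as Finₚ
open import Data.List
  using (List; []; _∷_; _++_; [_]; length; map; filter; upTo; tabulate; lookup; head; allFin; cartesianProduct)
open import Data.List.Extrema.Nat using (max; xs≤max; max≤v⁺)
open import Data.List.Membership.Propositional using (_∈_; _∉_; find; lose)
open import Data.List.Membership.Propositional.Properties
  using ( ∈-∃++; ∈-++⁻; ∈-++⁺ˡ; ∈-++⁺ʳ; ∈-filter⁺; ∈-filter⁻; ∈-lookup; ∈-allFin; ∈-cartesianProduct⁺
        ; ∈-map⁺; ∈-map⁻; ∈-upTo⁺; ∈-upTo⁻; ∈-tabulate⁺)
open import Data.List.Properties using (length-upTo; length-++; length-map; ++-assoc; length-tabulate)
open import Data.List.Relation.Binary.Subset.Propositional using (_⊆_)
open import Data.List.Relation.Binary.Subset.Propositional.Properties using (filter⁺′; ⊆-refl)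
open import Data.List.Relation.Unary.All using (All; []; _∷_)
  renaming (lookup to All-lookup; tabulate to All-tabulate)
import Data.List.Relation.Unary.All.Properties as All
open import Data.List.Relation.Unary.AllPairs using ([]; _∷_)
open import Data.List.Relation.Unary.Any using (here; there; any?)
open import Data.List.Relation.Unary.Linked as Linked using (Linked; []; [-]; _∷_)
open import Data.List.Relation.Unary.Unique.Propositional using (Unique)
import Data.List.Relation.Unary.Unique.Propositional.Properties as Unique
open import Data.Maybe using (just)
open import Data.Maybe.Properties using (just-injective)
open import Data.Nat using (ℕ; zero; suc; _+_; _⊔_; _≤_; _<_; z≤n; s≤s)
open import Data.Nat.Induction using (<-wellFounded)
import Data.Nat.Properties as ℕₚ
open ℕₚ
  using ( ≤-trans; ≤-pred; <⇒≱; 1+n≰n; m≤n+m; +-suc; +-comm; +-identityʳ; +-mono-≤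
        ; ⊔-lub; m≤m⊔n; m≤n⊔m; module ≤-Reasoning)
open import Data.Product as Product using (Σ-syntax; ∃-syntax; _×_; _,_; proj₁; proj₂; uncurry)
open import Data.Sum as Sum using (_⊎_; inj₁; inj₂; [_,_]′)
open import Function using (_∘_; Equivalence; _⇔_; mk⇔)
open import Induction.WellFounded using (Acc; acc)
open import Level using (0ℓ)
open import Relation.Binary.Definitions using (DecidableEquality; tri<; tri≈; tri>)
open import Relation.Binary.PropositionalEquality
  using (_≡_; _≢_; refl; sym; trans; cong; cong₂; subst; subst₂; module ≡-Reasoning)
open import Relation.Nullary using (¬_; Dec; does; yes; no; ¬?; decidable-stable)
open import Relation.Nullary.Decidable
  using ( _×-dec_; _⊎-dec_; dec-true; dec-false; toSum; isYes; isNo; isYes≗does; does-⇔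
        ; False; toWitnessFalse; fromWitnessFalse)
open import Relation.Unary using (Pred; Decidable) renaming (_⊆_ to _⋐_)

module _ {A : Set} where

  ∈-delete : ∀ {x z : A} xs {ys} → z ∈ xs ++ x ∷ ys → z ≢ x → z ∈ xs ++ ys
  ∈-delete xs z∈ z≢x with ∈-++⁻ xs z∈
  ... | inj₁ z∈xs         = ∈-++⁺ˡ z∈xs
  ... | inj₂ (here z≡x)   = ⊥-elim (z≢x z≡x)
  ... | inj₂ (there z∈ys) = ∈-++⁺ʳ xs z∈ys

  length-insert : ∀ (xs : List A) {x ys} → length (xs ++ x ∷ ys) ≡ suc (length (xs ++ ys))
  length-insert xs = trans (length-++ xs) (trans (+-suc _ _) (cong suc (sym (length-++ xs))))

  unique-⊆⇒length≤ : ∀ {xs ys : List A} → Unique xs → xs ⊆ ys → length xs ≤ length ys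
  unique-⊆⇒length≤ {[]} _ _ = z≤n
  unique-⊆⇒length≤ {x ∷ xs} (x∉xs ∷ xs!) xs⊆ys with ∈-∃++ (xs⊆ys (here refl))
  ... | pre , post , refl = subst (suc (length xs) ≤_) (sym (length-insert pre))
    (s≤s (unique-⊆⇒length≤ xs! λ z∈xs →
      ∈-delete pre (xs⊆ys (there z∈xs)) λ z≡x → All-lookup x∉xs z∈xs (sym z≡x)))

  length-filter-≤ : ∀ {P Q : Pred A 0ℓ} (P? : Decidable P) (Q? : Decidable Q) → P ⋐ Q →
    ∀ {xs} → Unique xs → length (filter P? xs) ≤ length (filter Q? xs)
  length-filter-≤ P? Q? P⋐Q {xs} xs! =
    unique-⊆⇒length≤ (Unique.filter⁺ P? xs!) (filter⁺′ P? Q? P⋐Q (⊆-refl {x = xs}))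

  length-filter-< : ∀ {P Q : Pred A 0ℓ} (P? : Decidable P) (Q? : Decidable Q) → P ⋐ Q →
    ∀ {x xs} → Unique xs → x ∈ xs → Q x → ¬ P x → length (filter P? xs) < length (filter Q? xs)
  length-filter-< {P} P? Q? P⋐Q {x} {xs} xs! x∈xs Qx ¬Px =
    unique-⊆⇒length≤ (x∉ ∷ Unique.filter⁺ P? xs!) x∷⊆
    where
    x∉ : All (x ≢_) (filter P? xs)
    x∉ = All.¬Any⇒All¬ _ (¬Px ∘ proj₂ ∘ ∈-filter⁻ P? {xs = xs})
    x∷⊆ : x ∷ filter P? xs ⊆ filter Q? xs
    x∷⊆ (here refl) = ∈-filter⁺ Q? x∈xs Qx
    x∷⊆ (there y∈) = filter⁺′ P? Q? P⋐Q (⊆-refl {x = xs}) y∈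

  unique-map⁺ : ∀ {B : Set} {f : A → B} {xs} → (∀ {x y} → x ∈ xs → y ∈ xs → x ≢ y → f x ≢ f y) →
    Unique xs → Unique (map f xs)
  unique-map⁺ {xs = []}     _     []          = []
  unique-map⁺ {xs = x ∷ xs} f-inj (x∉ ∷ xs!) =
    All.map⁺ (All-tabulate λ y∈ → f-inj (here refl) (there y∈) (All-lookup x∉ y∈)) ∷
    unique-map⁺ (λ y∈ z∈ → f-inj (there y∈) (there z∈)) xs!

  Unique-++⁻ˡ : ∀ (xs : List A) {ys} → Unique (xs ++ ys) → Unique xs
  Unique-++⁻ˡ []       _            = []
  Unique-++⁻ˡ (x ∷ xs) (x∉ ∷ xs!) = All.++⁻ˡ xs x∉ ∷ Unique-++⁻ˡ xs xs!

  Linked-++⁻ˡ : ∀ {R : A → A → Set} (xs : List A) {ys} → Linked R (xs ++ ys) → Linked R xs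
  Linked-++⁻ˡ []           _          = []
  Linked-++⁻ˡ (x ∷ [])     _          = [-]
  Linked-++⁻ˡ (x ∷ y ∷ xs) (r ∷ rs) = r ∷ Linked-++⁻ˡ (y ∷ xs) rs

  Unique-swap : ∀ {x y : A} {xs} → Unique (x ∷ y ∷ xs) → Unique (y ∷ x ∷ xs)
  Unique-swap ((x≢y ∷ x∉) ∷ y∉ ∷ xs!) = ((λ y≡x → x≢y (sym y≡x)) ∷ y∉) ∷ x∉ ∷ xs!

  lookup-injective : ∀ {xs : List A} → Unique xs → ∀ {i j} → lookup xs i ≡ lookup xs j → i ≡ j
  lookup-injective {x ∷ xs} _          {zero}  {zero}  _ = refl
  lookup-injective {x ∷ xs} (x∉ ∷ _)   {zero}  {suc j} x≡ = ⊥-elim (All-lookup x∉ (∈-lookup j) x≡)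
  lookup-injective {x ∷ xs} (x∉ ∷ _)   {suc i} {zero}  ≡x = ⊥-elim (All-lookup x∉ (∈-lookup i) (sym ≡x))
  lookup-injective {x ∷ xs} (_ ∷ xs!) {suc i} {suc j} eq = cong suc (lookup-injective xs! eq)

  Linked-lookup : ∀ {R : A → A → Set} {x xs} → Linked R (x ∷ xs) →
    ∀ (i : Fin (length xs)) → R (lookup (x ∷ xs) (inject₁ i)) (lookup (x ∷ xs) (suc i))
  Linked-lookup (r ∷ _)  zero    = r
  Linked-lookup (_ ∷ rs) (suc i) = Linked-lookup rs i

  lookup-last : ∀ (x : A) xs w → lookup (x ∷ xs ++ [ w ]) (fromℕ (length (xs ++ [ w ]))) ≡ w
  lookup-last x []       w = refl
  lookup-last x (y ∷ xs) w = lookup-last y xs w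

module _ {A : Set} (_≟_ : DecidableEquality A) where
  open import Data.List.Membership.DecPropositional _≟_ using (_∈?_)

  ∃-∈-∉ : ∀ {xs ys : List A} → Unique xs → length ys < length xs → ∃[ x ] x ∈ xs × x ∉ ys
  ∃-∈-∉ {xs} {ys} xs! ys<xs with any? (λ x → ¬? (x ∈? ys)) xs
  ... | yes ∃∉ = find ∃∉
  ... | no ∄∉  = ⊥-elim (<⇒≱ ys<xs (unique-⊆⇒length≤ xs! xs⊆ys))
    where
    xs⊆ys : xs ⊆ ys
    xs⊆ys {x} x∈xs = decidable-stable (x ∈? ys) λ x∉ys → ∄∉ (lose x∈xs x∉ys)

module _ {n} (H : SimpleGraph n) where

  Adj-sym : ∀ {u v} → Adj H u v → Adj H v u
  Adj-sym {u} {v} = subst T (SimpleGraph.sym H u v)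

  Adj-irrefl : ∀ {v} → ¬ Adj H v v
  Adj-irrefl {v} = subst T (irrefl H v)

  Adj⇒≢ : ∀ {u v} → Adj H u v → u ≢ v
  Adj⇒≢ uv refl = Adj-irrefl uv

module _ {n : ℕ} where

  _⊆ᴳ_ : SimpleGraph n → SimpleGraph n → Set
  H ⊆ᴳ G = ∀ {u v} → Adj H u v → Adj G u v

  neighbours : SimpleGraph n → Fin n → List (Fin n)
  neighbours H x = filter (T? ∘ adj H x) (allFin n)

  degree : SimpleGraph n → Fin n → ℕ
  degree H x = length (neighbours H x)

  arcs : SimpleGraph n → List (Fin n × Fin n)
  arcs H = filter (T? ∘ uncurry (adj H)) (cartesianProduct (allFin n) (allFin n))

  neighbours-unique : ∀ H x → Unique (neighbours H x)
  neighbours-unique H x = Unique.filter⁺ (T? ∘ adj H x) (Unique.allFin⁺ n)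

  ∈-neighbours : ∀ {H x w} → Adj H x w → w ∈ neighbours H x
  ∈-neighbours {H} {x} {w} xw = ∈-filter⁺ (T? ∘ adj H x) (∈-allFin w) xw

  degree≤length : ∀ {H x ys} → (∀ {w} → Adj H x w → w ∈ ys) → degree H x ≤ length ys
  degree≤length {H} {x} N⊆ys = unique-⊆⇒length≤ (neighbours-unique H x)
    λ w∈ → N⊆ys (proj₂ (∈-filter⁻ (T? ∘ adj H x) {xs = allFin n} w∈))

  degree-mono : ∀ {H G} → H ⊆ᴳ G → ∀ x → degree H x ≤ degree G x
  degree-mono {H} {G} H⊆G x =
    length-filter-≤ (T? ∘ adj H x) (T? ∘ adj G x) H⊆G (Unique.allFin⁺ n)

  longCycle-mono : ∀ {H G} → H ⊆ᴳ G → HasLongCycle H → HasLongCycle G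
  longCycle-mono H⊆G (l , 3≤l , c , c-inj , steps , closing) =
    l , 3≤l , c , c-inj , H⊆G ∘ steps , H⊆G closing

-- Graphs without long cycles have a pendant edge or a peripheral triangle

module _ {n} (H : SimpleGraph n) where
  open import Data.List.Membership.DecPropositional (Finₚ._≟_ {n}) using (_∈?_)

  chord⇒longCycle : ∀ x xs w {ys} → 2 ≤ length xs →
    Unique (x ∷ xs ++ w ∷ ys) → Linked (Adj H) (x ∷ xs ++ w ∷ ys) → Adj H x w → HasLongCycle H
  chord⇒longCycle x xs w {ys} 2≤ xs! path xw =
    length (xs ++ [ w ]) , 3≤ , lookup cycle ,
    lookup-injective (Unique-++⁻ˡ cycle (subst Unique split xs!)) ,
    Linked-lookup (Linked-++⁻ˡ cycle (subst (Linked (Adj H)) split path)) ,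
    subst (λ z → Adj H z x) (sym (lookup-last x xs w)) (Adj-sym H xw)
    where
    cycle : List (Fin n)
    cycle = x ∷ xs ++ [ w ]
    split : x ∷ xs ++ w ∷ ys ≡ cycle ++ ys
    split = cong (x ∷_) (sym (++-assoc xs [ w ] ys))
    3≤ : 3 ≤ length (xs ++ [ w ])
    3≤ = subst (3 ≤_) (sym (trans (length-++ xs) (+-comm (length xs) 1))) (s≤s 2≤)

  data Peripheral : Set where
    pendant  : ∀ {a b} → Adj H a b → (∀ {w} → Adj H a w → w ≡ b) → Peripheral
    triangle : ∀ {a b c} → Adj H a b → Adj H a c → Adj H b c →
      (∀ {w} → Adj H a w → w ≡ b ⊎ w ≡ c) → (∀ {w} → Adj H b w → w ≡ a ⊎ w ≡ c) → Peripheral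

  record Path : Set where
    constructor path
    field
      start next : Fin n
      rest       : List (Fin n)
      unique     : Unique (start ∷ next ∷ rest)
      linked     : Linked (Adj H) (start ∷ next ∷ rest)

    vertices : List (Fin n)
    vertices = start ∷ next ∷ rest

  open Path

  Longer : Path → Set
  Longer p = Σ[ q ∈ Path ] length (vertices q) ≡ suc (length (vertices p))

  length-path≤n : ∀ p → length (vertices p) ≤ n
  length-path≤n p = subst (length (vertices p) ≤_) (length-tabulate (λ i → i))
    (unique-⊆⇒length≤ (unique p) (λ {x} _ → ∈-allFin x))

  module _ (noLongCycle : ¬ HasLongCycle H) where

    HeadClosed : Path → Set
    HeadClosed p = ∀ {w} → Adj H (start p) w → w ≡ next p ⊎ just w ≡ head (rest p)

    -- A neighbour of the start lying further along the path would close a cycle of length at least 4.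
    extendOrClosed : ∀ p → Longer p ⊎ HeadClosed p
    extendOrClosed p@(path x₀ x₁ rest x! ℓ)
      with Finₚ.any? (λ w → T? (adj H x₀ w) ×-dec ¬? (w ∈? vertices p))
    ... | yes (w , x₀w , w∉) =
      inj₁ (path w x₀ (x₁ ∷ rest) (All.¬Any⇒All¬ _ w∉ ∷ x!) (Adj-sym H x₀w ∷ ℓ) , refl)
    ... | no ∄w = inj₂ closed
      where
      onPath : ∀ {w} → Adj H x₀ w → w ∈ vertices p
      onPath {w} x₀w = decidable-stable (w ∈? vertices p) λ w∉ → ∄w (w , x₀w , w∉)
      closed : HeadClosed p
      closed x₀w with onPath x₀w
      ... | here refl = ⊥-elim (Adj-irrefl H x₀w)
      ... | there (here refl) = inj₁ refl
      ... | there (there w∈rest) with ∈-∃++ w∈rest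
      ...   | [] , _ , refl = inj₂ refl
      ...   | y ∷ pre , _ , refl =
        ⊥-elim (noLongCycle (chord⇒longCycle x₀ (x₁ ∷ y ∷ pre) _ (s≤s (s≤s z≤n)) x! ℓ x₀w))

    -- If x₀ x₁ x₂ … cannot be extended at x₀, then N(x₀) ⊆ {x₁, x₂}; if moreover x₀x₂ is an edge,
    -- retry with the path x₁ x₀ x₂ …, and if that is stuck too, x₀ x₁ x₂ is a triangle with N(x₁) ⊆ {x₀, x₂}.
    closed⇒longer⊎peripheral : ∀ p → HeadClosed p → Longer p ⊎ Peripheral
    closed⇒longer⊎peripheral (path x₀ x₁ [] _ ℓ) closed =
      inj₂ (pendant (Linked.head ℓ) λ x₀w → Sum.fromInj₁ (λ ()) (closed x₀w))
    closed⇒longer⊎peripheral (path x₀ x₁ (x₂ ∷ rest) x! ℓ) closed with T? (adj H x₀ x₂)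
    ... | no ¬x₀x₂ =
      inj₂ (pendant (Linked.head ℓ) λ x₀w → Sum.fromInj₁ (λ { refl → ⊥-elim (¬x₀x₂ x₀w) }) (closed x₀w))
    ... | yes x₀x₂ with extendOrClosed (path x₁ x₀ (x₂ ∷ rest) (Unique-swap x!)
                                         (Adj-sym H (Linked.head ℓ) ∷ x₀x₂ ∷ Linked.tail (Linked.tail ℓ)))
    ...   | inj₁ longer  = inj₁ longer
    ...   | inj₂ closed′ = inj₂ (triangle (Linked.head ℓ) x₀x₂ (Linked.head (Linked.tail ℓ))
                                  (Sum.map₂ just-injective ∘ closed) (Sum.map₂ just-injective ∘ closed′))

    growOrPeripheral : ∀ p → Longer p ⊎ Peripheral
    growOrPeripheral p = [ inj₁ , closed⇒longer⊎peripheral p ]′ (extendOrClosed p)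

    findPeripheral : ∀ fuel p → n ≤ length (vertices p) + fuel → Peripheral
    findPeripheral fuel p n≤ with growOrPeripheral p
    ... | inj₂ peripheral = peripheral
    findPeripheral zero    p n≤ | inj₁ (q , ∣q∣≡) =
      ⊥-elim (1+n≰n (≤-trans (subst (_≤ n) ∣q∣≡ (length-path≤n q)) (subst (n ≤_) (+-identityʳ _) n≤)))
    findPeripheral (suc f) p n≤ | inj₁ (q , ∣q∣≡) =
      findPeripheral f q (subst (n ≤_) (trans (+-suc _ f) (cong (_+ f) (sym ∣q∣≡))) n≤)

    edgeless⊎peripheral : (∀ a b → ¬ Adj H a b) ⊎ Peripheral
    edgeless⊎peripheral with Finₚ.any? (λ a → Finₚ.any? (λ b → T? (adj H a b)))
    ... | no ∄ab = inj₁ λ a b ab → ∄ab (a , b , ab)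
    ... | yes (a , b , ab) =
      inj₂ (findPeripheral n (path a b [] ((Adj⇒≢ H ab ∷ []) ∷ [] ∷ []) (ab ∷ [-])) (m≤n+m n 2))

module _ {n : ℕ} where

  SamePair : Fin n → Fin n → Fin n → Fin n → Set
  SamePair a b u v = (u ≡ a × v ≡ b) ⊎ (u ≡ b × v ≡ a)

  samePair? : ∀ a b u v → Dec (SamePair a b u v)
  samePair? a b u v = (u ≟ a ×-dec v ≟ b) ⊎-dec (u ≟ b ×-dec v ≟ a)

  SamePair-sym : ∀ {a b u v} → SamePair a b u v → SamePair a b v u
  SamePair-sym = Sum.swap ∘ Sum.map Product.swap Product.swap

  removeEdge : SimpleGraph n → Fin n → Fin n → SimpleGraph n
  removeEdge H a b = record
    { adj    = λ u v → adj H u v ∧ isNo (samePair? a b u v)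
    ; sym    = λ u v → cong₂ (λ x y → x ∧ not y) (SimpleGraph.sym H u v) (isYes-sym u v)
    ; irrefl = λ v → cong (_∧ _) (irrefl H v)
    }
    where
    isYes-sym : ∀ u v → isYes (samePair? a b u v) ≡ isYes (samePair? a b v u)
    isYes-sym u v = begin
      isYes (samePair? a b u v) ≡⟨ isYes≗does _ ⟩
      does (samePair? a b u v)  ≡⟨ does-⇔ (mk⇔ SamePair-sym SamePair-sym) (samePair? a b u v) (samePair? a b v u) ⟩
      does (samePair? a b v u)  ≡⟨ isYes≗does _ ⟨
      isYes (samePair? a b v u) ∎
      where open ≡-Reasoning

  module RemoveEdge (H : SimpleGraph n) (a b : Fin n) where

    private
      T-removeEdge : ∀ {u v} → Adj (removeEdge H a b) u v ⇔ (Adj H u v × False (samePair? a b u v))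
      T-removeEdge {u} {v} = T-∧ {adj H u v}

    removeEdge-⊆ : removeEdge H a b ⊆ᴳ H
    removeEdge-⊆ = proj₁ ∘ Equivalence.to T-removeEdge

    removeEdge-removed : ∀ {u v} → Adj (removeEdge H a b) u v → ¬ SamePair a b u v
    removeEdge-removed = toWitnessFalse ∘ proj₂ ∘ Equivalence.to T-removeEdge

    removeEdge-kept : ∀ {u v} → Adj H u v → ¬ SamePair a b u v → Adj (removeEdge H a b) u v
    removeEdge-kept uv ¬ab = Equivalence.from T-removeEdge (uv , fromWitnessFalse ¬ab)

    degree-removeEdge : ∀ {x y} → Adj H x y → SamePair a b x y → degree (removeEdge H a b) x < degree H x
    degree-removeEdge {x} {y} xy ab =
      length-filter-< (T? ∘ adj (removeEdge H a b) x) (T? ∘ adj H x) removeEdge-⊆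
        (Unique.allFin⁺ n) (∈-allFin y) xy (λ xy′ → removeEdge-removed xy′ ab)

    arcs-removeEdge : Adj H a b → length (arcs (removeEdge H a b)) < length (arcs H)
    arcs-removeEdge ab =
      length-filter-< (T? ∘ uncurry (adj (removeEdge H a b))) (T? ∘ uncurry (adj H)) removeEdge-⊆
        (Unique.cartesianProduct⁺ (Unique.allFin⁺ n) (Unique.allFin⁺ n))
        (∈-cartesianProduct⁺ (∈-allFin a) (∈-allFin b)) ab (λ ab′ → removeEdge-removed ab′ (inj₁ (refl , refl)))

-- List edge colouring, by induction on the number of edges

module EdgeChoosability {n : ℕ} (k : ℕ) (S : Fin n → Fin n → List ℕ) (S-sym : ∀ u v → S u v ≡ S v u)
  where

  record EdgeListColouring (H : SimpleGraph n) : Set where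
    field
      colour    : Fin n → Fin n → ℕ
      colour∈S  : ∀ {u v} → Adj H u v → colour u v ∈ S u v
      colourSym : ∀ {u v} → Adj H u v → colour u v ≡ colour v u
      proper    : ∀ {x y z} → Adj H x y → Adj H x z → y ≢ z → colour x y ≢ colour x z

  edgelessColouring : ∀ {H} → (∀ a b → ¬ Adj H a b) → EdgeListColouring H
  edgelessColouring edgeless = record
    { colour    = λ _ _ → 0
    ; colour∈S  = λ uv → ⊥-elim (edgeless _ _ uv)
    ; colourSym = λ uv → ⊥-elim (edgeless _ _ uv)
    ; proper    = λ xy _ _ → ⊥-elim (edgeless _ _ xy)
    }

  extendColouring : ∀ {H a b} → Adj H a b → length (S a b) ≡ k → Unique (S a b) →
    degree H a + degree H b ≤ suc k → EdgeListColouring (removeEdge H a b) → EdgeListColouring H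
  extendColouring {H} {a} {b} ab ∣Sab∣≡k Sab! light colouring′ = record
    { colour = colour ; colour∈S = colour∈S ; colourSym = colourSym ; proper = proper }
    where
    H′ : SimpleGraph n
    H′ = removeEdge H a b
    open RemoveEdge H a b
    open EdgeListColouring colouring′ renaming
      (colour to colour′; colour∈S to colour′∈S; colourSym to colour′Sym; proper to proper′)

    blocked : List ℕ
    blocked = map (colour′ a) (neighbours H′ a) ++ map (colour′ b) (neighbours H′ b)

    ∣blocked∣<k : length blocked < k
    ∣blocked∣<k = ≤-pred (begin
      suc (suc (length blocked))                          ≡⟨ cong (2 +_) ∣blocked∣≡ ⟩
      suc (suc (degree H′ a + degree H′ b))               ≡⟨ cong suc (sym (+-suc _ _)) ⟩
      suc (degree H′ a) + suc (degree H′ b)               ≤⟨ +-mono-≤ (degree-removeEdge ab (inj₁ (refl , refl)))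
                                                                     (degree-removeEdge (Adj-sym H ab) (inj₂ (refl , refl))) ⟩
      degree H a + degree H b                             ≤⟨ light ⟩
      suc k                                               ∎)
      where
      open ≤-Reasoning
      ∣blocked∣≡ : length blocked ≡ degree H′ a + degree H′ b
      ∣blocked∣≡ = trans (length-++ (map (colour′ a) (neighbours H′ a)))
        (cong₂ _+_ (length-map (colour′ a) (neighbours H′ a)) (length-map (colour′ b) (neighbours H′ b)))

    fresh : ∃[ c ] c ∈ S a b × c ∉ blocked
    fresh = ∃-∈-∉ ℕₚ._≟_ Sab! (subst (length blocked <_) (sym ∣Sab∣≡k) ∣blocked∣<k)

    c : ℕ
    c = proj₁ fresh

    colour : Fin n → Fin n → ℕ
    colour u v = if does (samePair? a b u v) then c else colour′ u v

    colour-removed : ∀ {u v} → SamePair a b u v → colour u v ≡ c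
    colour-removed {u} {v} uv = cong (if_then c else colour′ u v) (dec-true (samePair? a b u v) uv)

    colour-kept : ∀ {u v} → ¬ SamePair a b u v → colour u v ≡ colour′ u v
    colour-kept {u} {v} ¬uv = cong (if_then c else colour′ u v) (dec-false (samePair? a b u v) ¬uv)

    S-removed : ∀ {u v} → SamePair a b u v → S u v ≡ S a b
    S-removed (inj₁ (refl , refl)) = refl
    S-removed (inj₂ (refl , refl)) = S-sym b a

    samePair-functional : ∀ {x y z} → SamePair a b x y → SamePair a b x z → y ≡ z
    samePair-functional (inj₁ (refl , refl)) (inj₁ (_ , refl))  = refl
    samePair-functional (inj₂ (refl , refl)) (inj₂ (_ , refl))  = refl
    samePair-functional (inj₁ (refl , refl)) (inj₂ (a≡b , _))   = ⊥-elim (Adj⇒≢ H ab a≡b)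
    samePair-functional (inj₂ (refl , refl)) (inj₁ (b≡a , _))   = ⊥-elim (Adj⇒≢ H ab (sym b≡a))

    c≢blocked : ∀ {x y z} → SamePair a b x y → Adj H x z → ¬ SamePair a b x z → c ≢ colour′ x z
    c≢blocked {x} {y} {z} xy xz ¬xz c≡ = proj₂ (proj₂ fresh) (subst (_∈ blocked) (sym c≡) (blocked∋ xy))
      where
      z∈N′x : z ∈ neighbours H′ x
      z∈N′x = ∈-neighbours {H = H′} (removeEdge-kept xz ¬xz)
      blocked∋ : SamePair a b x y → colour′ x z ∈ blocked
      blocked∋ (inj₁ (refl , refl)) = ∈-++⁺ˡ (∈-map⁺ (colour′ a) z∈N′x)
      blocked∋ (inj₂ (refl , refl)) = ∈-++⁺ʳ (map (colour′ a) (neighbours H′ a)) (∈-map⁺ (colour′ b) z∈N′x)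

    colour∈S : ∀ {u v} → Adj H u v → colour u v ∈ S u v
    colour∈S {u} {v} uv with samePair? a b u v
    ... | yes uv≐ab = subst₂ _∈_ (sym (colour-removed uv≐ab)) (sym (S-removed uv≐ab)) (proj₁ (proj₂ fresh))
    ... | no ¬uv≐ab = subst (_∈ S u v) (sym (colour-kept ¬uv≐ab)) (colour′∈S (removeEdge-kept uv ¬uv≐ab))

    colourSym : ∀ {u v} → Adj H u v → colour u v ≡ colour v u
    colourSym {u} {v} uv with samePair? a b u v
    ... | yes uv≐ab = trans (colour-removed uv≐ab) (sym (colour-removed (SamePair-sym uv≐ab)))
    ... | no ¬uv≐ab = begin
      colour u v  ≡⟨ colour-kept ¬uv≐ab ⟩
      colour′ u v ≡⟨ colour′Sym (removeEdge-kept uv ¬uv≐ab) ⟩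
      colour′ v u ≡⟨ sym (colour-kept (¬uv≐ab ∘ SamePair-sym)) ⟩
      colour v u  ∎
      where open ≡-Reasoning

    proper : ∀ {x y z} → Adj H x y → Adj H x z → y ≢ z → colour x y ≢ colour x z
    proper {x} {y} {z} xy xz y≢z with samePair? a b x y | samePair? a b x z
    ... | yes xy≐ab | yes xz≐ab = ⊥-elim (y≢z (samePair-functional xy≐ab xz≐ab))
    ... | yes xy≐ab | no ¬xz≐ab = λ eq →
      c≢blocked xy≐ab xz ¬xz≐ab (trans (sym (colour-removed xy≐ab)) (trans eq (colour-kept ¬xz≐ab)))
    ... | no ¬xy≐ab | yes xz≐ab = λ eq →
      c≢blocked xz≐ab xy ¬xy≐ab (trans (sym (colour-removed xz≐ab)) (trans (sym eq) (colour-kept ¬xy≐ab)))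
    ... | no ¬xy≐ab | no ¬xz≐ab = λ eq →
      proper′ (removeEdge-kept xy ¬xy≐ab) (removeEdge-kept xz ¬xz≐ab) y≢z
        (trans (sym (colour-kept ¬xy≐ab)) (trans eq (colour-kept ¬xz≐ab)))

  record Conditions (H : SimpleGraph n) : Set where
    field
      noLongCycle  : ¬ HasLongCycle H
      degree≤k     : ∀ x → degree H x ≤ k
      triangle⇒3≤k : ∀ {a b c} → Adj H a b → Adj H a c → Adj H b c → 3 ≤ k
      ∣S∣≡k        : ∀ {u v} → Adj H u v → length (S u v) ≡ k
      S-unique     : ∀ {u v} → Adj H u v → Unique (S u v)

  Conditions-⊆ : ∀ {H G} → H ⊆ᴳ G → Conditions G → Conditions H
  Conditions-⊆ {H} {G} H⊆G conds = record
    { noLongCycle  = noLongCycle ∘ longCycle-mono {H = H} {G} H⊆G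
    ; degree≤k     = λ x → ≤-trans (degree-mono {H = H} {G} H⊆G x) (degree≤k x)
    ; triangle⇒3≤k = λ ab ac bc → triangle⇒3≤k (H⊆G ab) (H⊆G ac) (H⊆G bc)
    ; ∣S∣≡k        = ∣S∣≡k ∘ H⊆G
    ; S-unique     = S-unique ∘ H⊆G
    }
    where open Conditions conds

  lightEdge : ∀ {H} → Conditions H → Peripheral H →
    Σ[ a ∈ Fin n ] Σ[ b ∈ Fin n ] Adj H a b × degree H a + degree H b ≤ suc k
  lightEdge {H} conds (pendant {a} {b} ab a-leaf) =
    a , b , ab , +-mono-≤ (degree≤length {H = H} {ys = b ∷ []} (here ∘ a-leaf)) (degree≤k b)
    where open Conditions conds
  lightEdge {H} conds (triangle {a} {b} ab ac bc Na Nb) =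
    a , b , ab ,
    ≤-trans (+-mono-≤ (degree≤length {H = H} (inTwo ∘ Na)) (degree≤length {H = H} (inTwo ∘ Nb)))
            (s≤s (triangle⇒3≤k ab ac bc))
    where
    open Conditions conds
    inTwo : ∀ {w x y : Fin n} → w ≡ x ⊎ w ≡ y → w ∈ x ∷ y ∷ []
    inTwo = Sum.[ here , there ∘ here ]

  listColouring : ∀ H → Conditions H → EdgeListColouring H
  listColouring H = go H (<-wellFounded (length (arcs H)))
    where
    go : ∀ H → Acc _<_ (length (arcs H)) → Conditions H → EdgeListColouring H
    go H (acc smaller) conds with edgeless⊎peripheral H (Conditions.noLongCycle conds)
    ... | inj₁ edgeless = edgelessColouring edgeless
    ... | inj₂ peripheral with lightEdge conds peripheral
    ...   | a , b , ab , light = extendColouring ab (∣S∣≡k ab) (S-unique ab) light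
      (go H′ (smaller (arcs-removeEdge ab)) (Conditions-⊆ removeEdge-⊆ conds))
      where
      open Conditions conds
      open RemoveEdge H a b
      H′ : SimpleGraph n
      H′ = removeEdge H a b

-- The line graph

module LineGraph {n} (G : SimpleGraph n) where

  Joins : Edge G → Fin n → Fin n → Set
  Joins (u , v , _) x y = SamePair x y u v

  Joins-swap : ∀ {e x y} → Joins e x y → Joins e y x
  Joins-swap {u , v , _} = Sum.swap

  Joins-adj : ∀ {e x y} → Joins e x y → Adj G x y
  Joins-adj {u , v , _ , uv} (inj₁ (refl , refl)) = uv
  Joins-adj {u , v , _ , uv} (inj₂ (refl , refl)) = Adj-sym G uv

  Joins-injective : ∀ {e f x y} → Joins e x y → Joins f x y → e ≡ f
  Joins-injective {u , v , u<v , uv} {_ , _ , u<v′ , uv′} (inj₁ (refl , refl)) (inj₁ (refl , refl)) =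
    cong₂ (λ p q → u , v , p , q) (Finₚ.<-irrelevant u<v u<v′) (T-irrelevant uv uv′)
  Joins-injective {u , v , u<v , uv} {_ , _ , u<v′ , uv′} (inj₂ (refl , refl)) (inj₂ (refl , refl)) =
    cong₂ (λ p q → u , v , p , q) (Finₚ.<-irrelevant u<v u<v′) (T-irrelevant uv uv′)
  Joins-injective {_ , _ , u<v , _} {_ , _ , v<u , _} (inj₁ (refl , refl)) (inj₂ (refl , refl)) =
    ⊥-elim (Finₚ.<-asym u<v v<u)
  Joins-injective {_ , _ , u<v , _} {_ , _ , v<u , _} (inj₂ (refl , refl)) (inj₁ (refl , refl)) =
    ⊥-elim (Finₚ.<-asym u<v v<u)

  Joins-functional : ∀ {e x y z} → Joins e x y → Joins e x z → y ≡ z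
  Joins-functional {_ , _ , _ , _} (inj₁ (refl , refl)) (inj₁ (_ , refl)) = refl
  Joins-functional {_ , _ , _ , _} (inj₂ (refl , refl)) (inj₂ (refl , _)) = refl
  Joins-functional {_ , _ , _ , uv} (inj₁ (refl , refl)) (inj₂ (_ , v≡u)) = ⊥-elim (Adj⇒≢ G uv (sym v≡u))
  Joins-functional {_ , _ , _ , uv} (inj₂ (refl , refl)) (inj₁ (u≡v , _)) = ⊥-elim (Adj⇒≢ G uv u≡v)

  edgeJoining : ∀ {u v} → Adj G u v → Σ[ e ∈ Edge G ] Joins e u v
  edgeJoining {u} {v} uv with Finₚ.<-cmp u v
  ... | tri< u<v _ _  = (u , v , u<v , uv) , inj₁ (refl , refl)
  ... | tri≈ _ refl _ = ⊥-elim (Adj-irrefl G uv)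
  ... | tri> _ _ v<u  = (v , u , v<u , Adj-sym G uv) , inj₂ (refl , refl)

  Meet : Edge G → Edge G → Set
  Meet e f = ∃[ x ] ∃[ y ] ∃[ z ] Joins e x y × Joins f x z × y ≢ z

  meet⇒distinct : ∀ {e f} → Meet e f → e ≢ f
  meet⇒distinct {e} (_ , _ , _ , ex , fx , y≢z) refl = y≢z (Joins-functional {e} ex fx)

  meet⇒lineAdj : ∀ {e f} → Meet e f → LineAdj G e f
  meet⇒lineAdj {_ , _ , _} {_ , _ , _} m@(_ , _ , _ , inj₁ (refl , _) , inj₁ (refl , _) , _) =
    meet⇒distinct m , inj₁ refl
  meet⇒lineAdj {_ , _ , _} {_ , _ , _} m@(_ , _ , _ , inj₁ (refl , _) , inj₂ (_ , refl) , _) =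
    meet⇒distinct m , inj₂ (inj₁ refl)
  meet⇒lineAdj {_ , _ , _} {_ , _ , _} m@(_ , _ , _ , inj₂ (_ , refl) , inj₁ (refl , _) , _) =
    meet⇒distinct m , inj₂ (inj₂ (inj₁ refl))
  meet⇒lineAdj {_ , _ , _} {_ , _ , _} m@(_ , _ , _ , inj₂ (_ , refl) , inj₂ (_ , refl) , _) =
    meet⇒distinct m , inj₂ (inj₂ (inj₂ refl))

  distinctEdges⇒meet : ∀ {e f x y z} → e ≢ f → Joins e x y → Joins f x z → Meet e f
  distinctEdges⇒meet e≢f ex fx = _ , _ , _ , ex , fx , λ { refl → e≢f (Joins-injective ex fx) }

  lineAdj⇒meet : ∀ {e f} → LineAdj G e f → Meet e f
  lineAdj⇒meet {_ , _ , _} {_ , _ , _} (e≢f , inj₁ refl) =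
    distinctEdges⇒meet e≢f (inj₁ (refl , refl)) (inj₁ (refl , refl))
  lineAdj⇒meet {_ , _ , _} {_ , _ , _} (e≢f , inj₂ (inj₁ refl)) =
    distinctEdges⇒meet e≢f (inj₁ (refl , refl)) (inj₂ (refl , refl))
  lineAdj⇒meet {_ , _ , _} {_ , _ , _} (e≢f , inj₂ (inj₂ (inj₁ refl))) =
    distinctEdges⇒meet e≢f (inj₂ (refl , refl)) (inj₁ (refl , refl))
  lineAdj⇒meet {_ , _ , _} {_ , _ , _} (e≢f , inj₂ (inj₂ (inj₂ refl))) =
    distinctEdges⇒meet e≢f (inj₂ (refl , refl)) (inj₂ (refl , refl))

  maxDegree : ℕ
  maxDegree = max 0 (tabulate (degree G))

  HasTriangle : Set
  HasTriangle = Σ[ a ∈ Fin n ] Σ[ b ∈ Fin n ] Σ[ c ∈ Fin n ] Adj G a b × Adj G a c × Adj G b c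

  hasTriangle? : Dec HasTriangle
  hasTriangle? = Finₚ.any? λ a → Finₚ.any? λ b → Finₚ.any? λ c →
    T? (adj G a b) ×-dec T? (adj G a c) ×-dec T? (adj G b c)

  χ′ : ℕ
  χ′ = maxDegree ⊔ (if does hasTriangle? then 3 else 0)

  degree≤χ′ : ∀ x → degree G x ≤ χ′
  degree≤χ′ x = ≤-trans (All-lookup (xs≤max 0 (tabulate (degree G))) (∈-tabulate⁺ x)) (m≤m⊔n maxDegree _)

  triangle⇒3≤χ′ : HasTriangle → 3 ≤ χ′
  triangle⇒3≤χ′ t =
    subst (λ b → 3 ≤ maxDegree ⊔ (if b then 3 else 0)) (sym (dec-true hasTriangle? t)) (m≤n⊔m maxDegree 3)

  χ′-lub : ∀ {m} → (∀ x → degree G x ≤ m) → (HasTriangle → 3 ≤ m) → χ′ ≤ m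
  χ′-lub {m} degree≤m triangle⇒3≤m = ⊔-lub (max≤v⁺ z≤n (All.tabulate⁺ degree≤m)) (threeIf≤ hasTriangle?)
    where
    threeIf≤ : (d : Dec HasTriangle) → (if does d then 3 else 0) ≤ m
    threeIf≤ (yes t) = triangle⇒3≤m t
    threeIf≤ (no _)  = z≤n

  module _ {m} (c : Edge G → Fin m) (proper : ∀ e f → LineAdj G e f → c e ≢ c f) where

    colourAt : Fin n → Fin n → ℕ
    colourAt v w with T? (adj G v w)
    ... | yes vw = toℕ (c (proj₁ (edgeJoining vw)))
    ... | no _   = 0

    colourAt-joins : ∀ {e v w} → Joins e v w → colourAt v w ≡ toℕ (c e)
    colourAt-joins {e} {v} {w} ev with T? (adj G v w)
    ... | yes vw = cong (toℕ ∘ c) (Joins-injective (proj₂ (edgeJoining vw)) ev)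
    ... | no ¬vw = ⊥-elim (¬vw (Joins-adj {e} ev))

    degree≤colours : ∀ v → degree G v ≤ m
    degree≤colours v = begin
      degree G v                                ≡⟨ sym (length-map (colourAt v) (neighbours G v)) ⟩
      length (map (colourAt v) (neighbours G v)) ≤⟨ unique-⊆⇒length≤ (unique-map⁺ distinct (neighbours-unique G v)) bounded ⟩
      length (upTo m)                           ≡⟨ length-upTo m ⟩
      m                                         ∎
      where
      open ≤-Reasoning
      adjacent : ∀ {w} → w ∈ neighbours G v → Adj G v w
      adjacent = proj₂ ∘ ∈-filter⁻ (T? ∘ adj G v) {xs = allFin n}
      distinct : ∀ {w w′} → w ∈ neighbours G v → w′ ∈ neighbours G v → w ≢ w′ →
        colourAt v w ≢ colourAt v w′
      distinct w∈ w′∈ w≢w′ eq with edgeJoining (adjacent w∈) | edgeJoining (adjacent w′∈)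
      ... | e , ev | f , fv = proper e f (meet⇒lineAdj (_ , _ , _ , ev , fv , w≢w′))
        (Finₚ.toℕ-injective (trans (sym (colourAt-joins ev)) (trans eq (colourAt-joins fv))))
      bounded : map (colourAt v) (neighbours G v) ⊆ upTo m
      bounded z∈ with ∈-map⁻ (colourAt v) z∈
      ... | w , w∈ , refl with edgeJoining (adjacent w∈)
      ...   | e , ev = ∈-upTo⁺ (subst (_< m) (sym (colourAt-joins ev)) (Finₚ.toℕ<n (c e)))

    triangle⇒3≤colours : HasTriangle → 3 ≤ m
    triangle⇒3≤colours (a , b , d , ab , ad , bd) =
      subst (3 ≤_) (length-tabulate (λ i → i)) (unique-⊆⇒length≤ colours! (λ {x} _ → ∈-allFin x))
      where
      eab : Σ[ e ∈ Edge G ] Joins e a b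
      eab = edgeJoining ab
      ead : Σ[ e ∈ Edge G ] Joins e a d
      ead = edgeJoining ad
      ebd : Σ[ e ∈ Edge G ] Joins e b d
      ebd = edgeJoining bd
      distinct : ∀ {e f x y z} → Joins e x y → Joins f x z → y ≢ z → c e ≢ c f
      distinct ex fx y≢z = proper _ _ (meet⇒lineAdj (_ , _ , _ , ex , fx , y≢z))
      colours! : Unique (c (proj₁ eab) ∷ c (proj₁ ead) ∷ c (proj₁ ebd) ∷ [])
      colours! =
        (distinct (proj₂ eab) (proj₂ ead) (Adj⇒≢ G bd) ∷
         distinct (Joins-swap {proj₁ eab} (proj₂ eab)) (proj₂ ebd) (Adj⇒≢ G ad) ∷ []) ∷
        (distinct (Joins-swap {proj₁ ead} (proj₂ ead)) (Joins-swap {proj₁ ebd} (proj₂ ebd)) (Adj⇒≢ G ab) ∷ []) ∷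
        [] ∷ []

  χ′≤colours : ∀ m → Colourable (LineAdj G) m → χ′ ≤ m
  χ′≤colours m (c , proper) = χ′-lub (degree≤colours c proper) (triangle⇒3≤colours c proper)

  module _ (S : Edge G → List ℕ) where

    listsAt : Fin n → Fin n → List ℕ
    listsAt u v with T? (adj G u v)
    ... | yes uv = S (proj₁ (edgeJoining uv))
    ... | no _   = []

    listsAt-joins : ∀ {e u v} → Joins e u v → listsAt u v ≡ S e
    listsAt-joins {e} {u} {v} eu with T? (adj G u v)
    ... | yes uv = cong S (Joins-injective (proj₂ (edgeJoining uv)) eu)
    ... | no ¬uv = ⊥-elim (¬uv (Joins-adj {e} eu))

    listsAt-nonadjacent : ∀ {u v} → ¬ Adj G u v → listsAt u v ≡ []
    listsAt-nonadjacent {u} {v} ¬uv with T? (adj G u v)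
    ... | yes uv = ⊥-elim (¬uv uv)
    ... | no _   = refl

    listsAt-sym : ∀ u v → listsAt u v ≡ listsAt v u
    listsAt-sym u v = [ adjacent , nonadjacent ]′ (toSum (T? (adj G u v)))
      where
      adjacent : Adj G u v → listsAt u v ≡ listsAt v u
      adjacent uv = let (e , eu) = edgeJoining uv in
        trans (listsAt-joins {e} eu) (sym (listsAt-joins {e} (Joins-swap {e} eu)))
      nonadjacent : ¬ Adj G u v → listsAt u v ≡ listsAt v u
      nonadjacent ¬uv = trans (listsAt-nonadjacent ¬uv) (sym (listsAt-nonadjacent (¬uv ∘ Adj-sym G)))

  lineGraph-choosable : ¬ HasLongCycle G → Choosable (LineAdj G) χ′
  lineGraph-choosable noLongCycle S ∣S∣≡χ′ S! = colourEdge , colourEdge∈S , properEdge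
    where
    open EdgeChoosability χ′ (listsAt S) (listsAt-sym S)
    conditions : Conditions G
    conditions = record
      { noLongCycle  = noLongCycle
      ; degree≤k     = degree≤χ′
      ; triangle⇒3≤k = λ ab ac bc → triangle⇒3≤χ′ (_ , _ , _ , ab , ac , bc)
      ; ∣S∣≡k        = λ uv → let (e , eu) = edgeJoining uv in
                               trans (cong length (listsAt-joins S {e} eu)) (∣S∣≡χ′ e)
      ; S-unique     = λ uv → let (e , eu) = edgeJoining uv in
                               subst Unique (sym (listsAt-joins S {e} eu)) (S! e)
      }
    open EdgeListColouring (listColouring G conditions)

    colourEdge : Edge G → ℕ
    colourEdge (u , v , _) = colour u v

    colourEdge-joins : ∀ {e x y} → Joins e x y → colourEdge e ≡ colour x y
    colourEdge-joins {_ , _ , _ , _}  (inj₁ (refl , refl)) = refl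
    colourEdge-joins {_ , _ , _ , uv} (inj₂ (refl , refl)) = colourSym uv

    colourEdge∈S : ∀ e → colourEdge e ∈ S e
    colourEdge∈S e@(_ , _ , _ , uv) =
      subst (colourEdge e ∈_) (listsAt-joins S {e} (inj₁ (refl , refl))) (colour∈S uv)

    properEdge : ∀ e f → LineAdj G e f → colourEdge e ≢ colourEdge f
    properEdge e f ef with lineAdj⇒meet ef
    ... | _ , _ , _ , ex , fx , y≢z = λ eq →
      proper (Joins-adj {e} ex) (Joins-adj {f} fx) y≢z
        (trans (sym (colourEdge-joins {e} ex)) (trans eq (colourEdge-joins {f} fx)))

choosable⇒colourable : ∀ {V : Set} {R : V → V → Set} {k} → Choosable R k → Colourable R k
choosable⇒colourable {k = k} choose with choose (λ _ → upTo k) (λ _ → length-upTo k) (λ _ → Unique.upTo⁺ k)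
... | c , c∈ , proper = (λ v → fromℕ< (∈-upTo⁻ (c∈ v))) , λ x y xRy cx≡cy → proper x y xRy (begin
  c x                          ≡⟨ sym (Finₚ.toℕ-fromℕ< _) ⟩
  toℕ (fromℕ< (∈-upTo⁻ (c∈ x))) ≡⟨ cong toℕ cx≡cy ⟩
  toℕ (fromℕ< (∈-upTo⁻ (c∈ y))) ≡⟨ Finₚ.toℕ-fromℕ< _ ⟩
  c y                          ∎)
  where open ≡-Reasoning

corollary11 : ∀ {n} (G : SimpleGraph n) → ¬ HasLongCycle G →
    Σ[ k ∈ ℕ ] (IsChoiceNumber (LineAdj G) k × IsChromaticNumber (LineAdj G) k)
corollary11 G noLongCycle =
  χ′ , (choosable , λ m → χ′≤colours m ∘ choosable⇒colourable)
     , (choosable⇒colourable choosable , χ′≤colours)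
  where
  open LineGraph G
  choosable : Choosable (LineAdj G) χ′
  choosable = lineGraph-choosable noLongCycle
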